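{- Let $G$ be a connected undirected simple graph with $n\ge k$ vertices, and let $U\neq\emptyset$ be a vertex set such that $G[U]$ is connected and $|U|\le k-2$. Let $x$ and $y$ be distinct vertices in $N(U)$. If both $x$ and $y$ are mandatory for $G,U,k$, then $n<2k$.
   Context: $N(U)=\bigcup_{u\in U}N(u)\setminus U$ is the open neighbourhood of $U$. A vertex $v$ is mandatory for $G,U,k$ if the connected component of $G-v$ containing the vertices of $U$ has at most $k-1$ vertices. -}

module Defs where

open import Data.Nat using (ℕ; _≤_; _∸_)
open import Data.Fin using (Fin)
open import Data.Fin.Subset using (Subset; _∈_; _∉_)
open import Data.List using (List; length)
open import Data.List.Relation.Unary.All using (All)
open import Data.List.Relation.Unary.Unique.Propositional using (Unique)
open import Data.Product using (Σ; ∃; _×_)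
open import Relation.Nullary using (¬_; Dec)
open import Relation.Binary.PropositionalEquality using (_≡_; _≢_)

record Graph (n : ℕ) : Set₁ where
  field
    Adj   : Fin n → Fin n → Set
    dec   : ∀ a b → Dec (Adj a b)
    sym   : ∀ {a b} → Adj a b → Adj b a
    irrefl : ∀ {a} → ¬ Adj a a
open Graph public

-- Walks from a to b all of whose vertices satisfy P
-- (i.e. walks in the induced subgraph G[P]).
data Walk {n : ℕ} (G : Graph n) (P : Fin n → Set) : Fin n → Fin n → Set where
  here : ∀ {a} → P a → Walk G P a a
  step : ∀ {a b c} → P a → Adj G a b → Walk G P b c → Walk G P a c

Connected : ∀ {n} → Graph n → Set
Connected {n} G = ∀ (a b : Fin n) → Walk G (λ _ → Fin n) a b

InducedConnected : ∀ {n} → Graph n → Subset n → Set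
InducedConnected {n} G U = ∀ (a b : Fin n) → a ∈ U → b ∈ U → Walk G (_∈ U) a b

InNbhd : ∀ {n} → Graph n → Subset n → Fin n → Set
InNbhd {n} G U x = x ∉ U × Σ (Fin n) (λ u → u ∈ U × Adj G u x)

-- w lies in the connected component of G - v containing the vertices of U
InComp : ∀ {n} → Graph n → Subset n → Fin n → Fin n → Set
InComp {n} G U v w = Σ (Fin n) (λ u → u ∈ U × Walk G (λ z → z ≢ v) u w)

AtMost : ∀ {n} → (Fin n → Set) → ℕ → Set
AtMost {n} S m = ∀ (ws : List (Fin n)) → Unique ws → All S ws → length ws ≤ m

Mandatory : ∀ {n} → Graph n → Subset n → ℕ → Fin n → Set
Mandatory G U k v = AtMost (InComp G U v) (k ∸ 1)

-- Every vertex w is reached from U in G - x or in G - y: follow a walk from y to w;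
-- as long as it avoids x it stays in the component of G - x containing U, and if it
-- hits x it continues inside the component of G - y containing U, which contains x
-- (a neighbour of U different from y), and symmetrically.  Both components have at
-- most k - 1 vertices, and k ≥ 1 because each of them is nonempty, so n ≤ 2k - 2 < 2k.
module Submission where

open import Defs
open import Data.Bool using (T; T?)
open import Data.Empty using (⊥-elim)
open import Data.Fin using (Fin; _≟_)
open import Data.Fin.Subset using (Subset; Nonempty; ∣_∣; _∉_)
open import Data.List using (List; []; _∷_; length; filter; allFin)
open import Data.List.Properties using (length-tabulate)
open import Data.List.Relation.Unary.All using (All; []; _∷_)
import Data.List.Relation.Unary.All as All
open import Data.List.Relation.Unary.All.Properties using (all-filter)
open import Data.List.Relation.Unary.AllPairs using ([]; _∷_)
open import Data.List.Relation.Unary.Unique.Propositional.Properties using (allFin⁺; filter⁺)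
open import Data.Maybe using (is-just; to-witness-T)
open import Data.Nat using (ℕ; suc; _+_; _*_; _∸_; _≤_; _<_; s≤s)
open import Data.Nat.Properties using (+-suc; +-mono-≤; m∸n≤m; ≤-refl; ≤-trans; n≤1+n; m≤m+n)
open import Data.Product using (_,_; proj₁)
open import Data.Sum using (_⊎_; inj₁; inj₂; isInj₁)
open import Data.Unit using (tt)
open import Function using (_∘_)
open import Relation.Binary.PropositionalEquality using (_≡_; _≢_; refl; cong; subst; trans)
open import Relation.Nullary using (yes; no; ¬_; ¬?)
open import Relation.Unary using (Pred; Decidable)

module _ {a p} {A : Set a} {P : Pred A p} (P? : Decidable P) where

  length-filter-+-filter-¬ : ∀ xs →
    length (filter P? xs) + length (filter (¬? ∘ P?) xs) ≡ length xs
  length-filter-+-filter-¬ []       = refl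
  length-filter-+-filter-¬ (x ∷ xs) with ih ← length-filter-+-filter-¬ xs | P? x
  ... | yes _ = cong suc ih
  ... | no _  = trans (+-suc (length (filter P? xs)) (length (filter (¬? ∘ P?) xs)))
                      (cong suc ih)

module _ {n} {A B : Fin n → Set} (cover : ∀ w → A w ⊎ B w) where

  -- A and B need not be decidable: the cover itself decides on which side w is counted.
  private
    Left : Fin n → Set
    Left w = T (is-just (isInj₁ (cover w)))

    left : ∀ {w} → Left w → A w
    left {w} = to-witness-T (isInj₁ (cover w))

    right : ∀ {w} → ¬ Left w → B w
    right {w} with cover w
    ... | inj₁ _  = λ notLeft → ⊥-elim (notLeft tt)
    ... | inj₂ bw = λ _ → bw

  AtMost-cover : ∀ {a b} → AtMost A a → AtMost B b → n ≤ a + b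
  AtMost-cover atMostA atMostB =
    subst (_≤ _) count (+-mono-≤ (atMostA lefts (filter⁺ Left? vertices-unique)
                                         (All.map left (all-filter Left? vertices)))
                                 (atMostB rights (filter⁺ (¬? ∘ Left?) vertices-unique)
                                         (All.map right (all-filter (¬? ∘ Left?) vertices))))
    where
    Left? : Decidable Left
    Left? w = T? (is-just (isInj₁ (cover w)))
    vertices = allFin n
    vertices-unique = allFin⁺ n
    lefts = filter Left? vertices
    rights = filter (¬? ∘ Left?) vertices
    count : length lefts + length rights ≡ n
    count rewrite length-filter-+-filter-¬ Left? vertices = length-tabulate (λ i → i)

Walk-snoc : ∀ {n} {G : Graph n} {P : Fin n → Set} {a b c} →
            Walk G P a b → Adj G b c → P c → Walk G P a c
Walk-snoc (here pa)     bc pc = step pa bc (here pc)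
Walk-snoc (step pa e w) bc pc = step pa e (Walk-snoc w bc pc)

module _ {n} (G : Graph n) (U : Subset n) where

  InComp-extend : ∀ {v a b} → InComp G U v a → Adj G a b → b ≢ v → InComp G U v b
  InComp-extend (u , u∈U , walk) ab b≢v = u , u∈U , Walk-snoc walk ab b≢v

  InNbhd⇒InComp : ∀ {v y} → v ∉ U → y ≢ v → InNbhd G U y → InComp G U v y
  InNbhd⇒InComp v∉U y≢v (_ , u , u∈U , uy) =
    u , u∈U , step (λ { refl → v∉U u∈U }) uy (here y≢v)

  module _ {x y} (y∈Cx : InComp G U x y) (x∈Cy : InComp G U y x) where

    InComp-cover-walk : ∀ {a w} → InComp G U x a ⊎ InComp G U y a →
                        Walk G (λ _ → Fin n) a w → InComp G U x w ⊎ InComp G U y w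
    InComp-cover-walk a∈C (here _) = a∈C
    InComp-cover-walk (inj₁ a∈Cx) (step {b = b} _ ab walk) with b ≟ x
    ... | yes refl = InComp-cover-walk (inj₂ x∈Cy) walk
    ... | no b≢x   = InComp-cover-walk (inj₁ (InComp-extend a∈Cx ab b≢x)) walk
    InComp-cover-walk (inj₂ a∈Cy) (step {b = b} _ ab walk) with b ≟ y
    ... | yes refl = InComp-cover-walk (inj₁ y∈Cx) walk
    ... | no b≢y   = InComp-cover-walk (inj₂ (InComp-extend a∈Cy ab b≢y)) walk

    InComp-cover : Connected G → ∀ w → InComp G U x w ⊎ InComp G U y w
    InComp-cover connected w = InComp-cover-walk (inj₁ y∈Cx) (connected y w)

AtMost-nonempty : ∀ {n} {S : Fin n → Set} {m w} → AtMost S m → S w → 1 ≤ m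
AtMost-nonempty atMost Sw = atMost (_ ∷ []) ([] ∷ []) (Sw ∷ [])

pred+pred<double : ∀ k → 1 ≤ k → (k ∸ 1) + (k ∸ 1) < 2 * k
pred+pred<double (suc j) _ = s≤s (+-mono-≤ (≤-refl {j}) (≤-trans (n≤1+n j) (m≤m+n (suc j) 0)))

lemma2 : ∀ (n k : ℕ) (G : Graph n) (U : Subset n) (x y : Fin n)
    → Connected G → k ≤ n
    → Nonempty U → InducedConnected G U → ∣ U ∣ ≤ k ∸ 2
    → InNbhd G U x → InNbhd G U y → x ≢ y
    → Mandatory G U k x → Mandatory G U k y
    → n < 2 * k
lemma2 n k G U x y connected _ _ _ _ x∈NU y∈NU x≢y x-mandatory y-mandatory =
  ≤-trans (s≤s n≤2[k∸1]) (pred+pred<double k 1≤k)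
  where
  y∈Cx : InComp G U x y
  y∈Cx = InNbhd⇒InComp G U (proj₁ x∈NU) (λ { refl → x≢y refl }) y∈NU
  x∈Cy : InComp G U y x
  x∈Cy = InNbhd⇒InComp G U (proj₁ y∈NU) x≢y x∈NU
  n≤2[k∸1] : n ≤ (k ∸ 1) + (k ∸ 1)
  n≤2[k∸1] = AtMost-cover (InComp-cover G U y∈Cx x∈Cy connected) x-mandatory y-mandatory
  1≤k : 1 ≤ k
  1≤k = ≤-trans (AtMost-nonempty x-mandatory y∈Cx) (m∸n≤m k 1)
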